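{- Let $\Phi$ be a real, additive gain graph on $\{1,\dots,n\}$ and $Q_1,\dots,Q_n\in\mathbb{E}^d$ with $Q_i\neq Q_j$ whenever $i,j$ are adjacent in $\Phi$. Let $C$ be a circle in $\Phi$ and $\mathcal{C}=\{h(e):e\in C\}\subseteq\mathcal{H}(\Phi;\mathbf{Q})$. If $C$ is unbalanced, then $\bigcap\mathcal{C}=\emptyset$. If $C$ is balanced and $e\in C$, then $\bigcap\mathcal{C}=\bigcap(\mathcal{C}\setminus\{h(e)\})$.
   Context: A real, additive gain graph: finite graph (multiple edges allowed, all edges links) with gains $\phi(e;i,j)\in\mathbb{R}$, $\phi(e;j,i)=-\phi(e;i,j)$. A circle is balanced if the sum of its gains, taken in a consistent direction around it, is $0$. $\mathcal{H}(\Phi;\mathbf{Q})$: for each edge $e$ with endpoints $i,j$, the hyperplane $h(e)=\{P\in\mathbb{E}^d:d(P,Q_i)^2-d(P,Q_j)^2=\phi(e;i,j)\}$. -}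

module Defs where

open import Level using (_⊔_)
open import Data.Nat using (ℕ; zero; suc; _%_)
open import Data.Nat.DivMod using (m%n<n)
open import Data.Fin using (Fin; zero; suc; toℕ; fromℕ<)
open import Data.Product using (_×_)
open import Data.Sum using (_⊎_)
open import Function.Definitions using (Injective)
open import Relation.Binary.PropositionalEquality using (_≡_; _≢_)
open import Relation.Nullary using (¬_)
open import Algebra.Bundles using (CommutativeRing)

next : ∀ {k} → Fin (suc k) → Fin (suc k)
next {k} t = fromℕ< (m%n<n (suc (toℕ t)) (suc k))

-- A finite graph on vertex set Fin n (= {1,…,n}) with m edges, multiple edges
-- allowed, every edge a link (two distinct endpoints), with additive gains in
-- the ring R.  gain e = φ(e; end₁ e, end₂ e); the reverse direction has gain
-- φ(e; end₂ e, end₁ e) = - gain e (see dgain below).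
record GainGraph {c ℓ} (R : CommutativeRing c ℓ) (n : ℕ) : Set c where
  open CommutativeRing R using (Carrier; _≈_; _+_; _*_; _-_; -_; 0#)
  field
    m    : ℕ
    end₁ : Fin m → Fin n
    end₂ : Fin m → Fin n
    link : ∀ e → end₁ e ≢ end₂ e
    gain : Fin m → Carrier

module _ {a ℓ} (R : CommutativeRing a ℓ) where
  open CommutativeRing R using (Carrier; _≈_; _+_; _*_; _-_; -_; 0#)

  Point : ℕ → Set a
  Point d = Fin d → Carrier

  sumF : ∀ {d} → (Fin d → Carrier) → Carrier
  sumF {zero}  f = 0#
  sumF {suc d} f = f zero + sumF (λ i → f (suc i))

  dist² : ∀ {d} → Point d → Point d → Carrier
  dist² P Q = sumF (λ k → (P k - Q k) * (P k - Q k))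

  _≉ₚ_ : ∀ {d} → Point d → Point d → Set ℓ
  P ≉ₚ Q = ¬ (∀ k → P k ≈ Q k)

  module _ {n : ℕ} (Φ : GainGraph R n) where
    open GainGraph Φ

    Joins : Fin m → Fin n → Fin n → Set
    Joins e a b = (end₁ e ≡ a × end₂ e ≡ b) ⊎ (end₁ e ≡ b × end₂ e ≡ a)

    record Circle : Set where
      field
        k      : ℕ
        v      : Fin (suc (suc k)) → Fin n
        c      : Fin (suc (suc k)) → Fin m
        v-inj  : Injective _≡_ _≡_ v
        c-inj  : Injective _≡_ _≡_ c
        joins  : ∀ t → Joins (c t) (v t) (v (next t))

    dgain : ∀ {e a b} → Joins e a b → Carrier
    dgain {e} (_⊎_.inj₁ _) = gain e
    dgain {e} (_⊎_.inj₂ _) = - gain e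

    circleGain : Circle → Carrier
    circleGain C = sumF (λ t → dgain (joins t))
      where open Circle C

    Balanced : Circle → Set ℓ
    Balanced C = circleGain C ≈ 0#

    _∈h_ : ∀ {d} {Q : Fin n → Point d} → Point d → Fin m → Set ℓ
    _∈h_ {Q = Q} P e = dist² P (Q (end₁ e)) - dist² P (Q (end₂ e)) ≈ gain e

    AdjDistinct : ∀ {d} → (Fin n → Point d) → Set ℓ
    AdjDistinct Q = ∀ e → Q (end₁ e) ≉ₚ Q (end₂ e)

-- Fix a point P and write pot(i) = d(P, Q_i)² for the "potential" of vertex i.
-- P lies on h(e) for an edge e traversed from a to b exactly when
--     φ(e; a, b) + pot(b) ≈ pot(a).
-- Around a circle C with vertices v 0, …, v (k+1), summing the right-hand
-- sides gives Σ pot(v t), while summing the left-hand sides gives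
-- (gain of C) + Σ pot(v (next t)) = (gain of C) + Σ pot(v t), because the
-- cyclic successor only permutes the summands.  Hence the two sums agree iff
-- C is balanced.  Both parts of the lemma follow:
--   * if P lies on every h(e), e ∈ C, the sums agree, so C is balanced;
--   * if C is balanced, the sums agree, and two families with equal sums that
--     agree at all indices but one agree everywhere, so any single h(e) is
--     implied by the others.
module Submission where

open import Defs
open import Level using (Level)
open import Data.Nat using (ℕ; suc; s≤s; _%_)
open import Data.Nat.DivMod using (m<n⇒m%n≡m; n%n≡0)
open import Data.Fin using (Fin; zero; suc; toℕ; fromℕ; inject₁; punchIn; _≟_)
open import Data.Fin.Properties using (toℕ-injective; toℕ-fromℕ<; toℕ-inject₁; toℕ<n; toℕ-fromℕ; punchInᵢ≢i)
open import Data.Product using (_×_; _,_)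
open import Data.Sum using (inj₁; inj₂)
open import Function using (_∘_; _⇔_; mk⇔; Equivalence)
open import Function.Properties.Equivalence using () renaming (trans to ⇔-trans)
open import Relation.Binary.PropositionalEquality using (_≡_; _≢_; refl; cong; module ≡-Reasoning)
open import Relation.Nullary using (¬_; yes; no)
open import Algebra.Bundles using (CommutativeRing)

open Equivalence using (to; from)

next-inject₁ : ∀ {k} (t : Fin k) → next (inject₁ t) ≡ suc t
next-inject₁ {k} t = toℕ-injective (begin
    toℕ (next (inject₁ t))         ≡⟨ toℕ-fromℕ< _ ⟩
    suc (toℕ (inject₁ t)) % suc k  ≡⟨ cong (λ x → suc x % suc k) (toℕ-inject₁ t) ⟩
    suc (toℕ t) % suc k            ≡⟨ m<n⇒m%n≡m (s≤s (toℕ<n t)) ⟩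
    suc (toℕ t)                    ∎)
  where open ≡-Reasoning

next-last : ∀ k → next (fromℕ k) ≡ zero
next-last k = toℕ-injective (begin
    toℕ (next (fromℕ k))         ≡⟨ toℕ-fromℕ< _ ⟩
    suc (toℕ (fromℕ k)) % suc k  ≡⟨ cong (λ x → suc x % suc k) (toℕ-fromℕ k) ⟩
    suc k % suc k                ≡⟨ n%n≡0 (suc k) ⟩
    0                            ∎)
  where open ≡-Reasoning

module _ {a ℓ : Level} (R : CommutativeRing a ℓ) where
  open CommutativeRing R hiding (zero; refl)
  open import Algebra.Properties.CommutativeMonoid.Sum +-commutativeMonoid
    using (sum; sum-cong-≋; sum-remove; sum-init-last; ∑-distrib-+)
  open import Algebra.Properties.Group +-group using (x≈z//y; //-rightDividesˡ; ∙-cancelʳ; identityˡ-unique; ⁻¹-involutive)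
  open import Algebra.Properties.AbelianGroup +-abelianGroup using (⁻¹-anti-homo‿-)
  open import Relation.Binary.Reasoning.Setoid setoid

  sumF≡sum : ∀ {d} (f : Fin d → Carrier) → sumF R f ≡ sum f
  sumF≡sum {0}     f = refl
  sumF≡sum {suc d} f = cong (f zero +_) (sumF≡sum (f ∘ suc))

  sum-rotate : ∀ {k} (g : Fin (suc k) → Carrier) → sum (g ∘ next) ≈ sum g
  sum-rotate {k} g = begin
    sum (g ∘ next)                                  ≈⟨ sum-init-last (g ∘ next) ⟩
    sum (g ∘ next ∘ inject₁) + g (next (fromℕ k))   ≈⟨ +-cong (sum-cong-≋ (λ t → reflexive (cong g (next-inject₁ t))))
                                                              (reflexive (cong g (next-last k))) ⟩
    sum (g ∘ suc) + g zero                          ≈⟨ +-comm _ _ ⟩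
    sum g                                           ∎

  sum-determines-missing-term : ∀ {n} (f g : Fin (suc n) → Carrier) (s : Fin (suc n)) →
    sum f ≈ sum g → (∀ t → t ≢ s → f t ≈ g t) → ∀ t → f t ≈ g t
  sum-determines-missing-term f g s Σf≈Σg agree t with t ≟ s
  ... | no t≢s   = agree t t≢s
  ... | yes refl = ∙-cancelʳ (sum (f ∘ punchIn t)) (f t) (g t) (begin
    f t + sum (f ∘ punchIn t)  ≈⟨ sum-remove f ⟨
    sum f                      ≈⟨ Σf≈Σg ⟩
    sum g                      ≈⟨ sum-remove g ⟩
    g t + sum (g ∘ punchIn t)  ≈⟨ +-congˡ (sum-cong-≋ (λ i → sym (agree _ (punchInᵢ≢i t i)))) ⟩
    g t + sum (f ∘ punchIn t)  ∎)

  difference⇔sum : ∀ x y z → (x - y ≈ z) ⇔ (z + y ≈ x)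
  difference⇔sum x y z = mk⇔
    (λ x-y≈z → trans (+-congʳ (sym x-y≈z)) (//-rightDividesˡ y x))
    (λ z+y≈x → sym (x≈z//y z y x z+y≈x))

  difference-swap⇔ : ∀ x y z → (y - x ≈ z) ⇔ (x - y ≈ - z)
  difference-swap⇔ x y z = mk⇔
    (λ y-x≈z → trans (sym (⁻¹-anti-homo‿- y x)) (-‿cong y-x≈z))
    (λ x-y≈-z → trans (sym (⁻¹-anti-homo‿- x y)) (trans (-‿cong x-y≈-z) (⁻¹-involutive z)))

  module _ {n d : ℕ} (Φ : GainGraph R n) (Q : Fin n → Point R d) (P : Point R d) where
    open GainGraph Φ using (gain)

    pot : Fin n → Carrier
    pot i = dist² R P (Q i)

    ∈h⇔potential-step : ∀ {e a b} (J : Joins R Φ e a b) →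
      _∈h_ R Φ {Q = Q} P e ⇔ (dgain R Φ J + pot b ≈ pot a)
    ∈h⇔potential-step (inj₁ (refl , refl)) = difference⇔sum _ _ _
    ∈h⇔potential-step {e} (inj₂ (refl , refl)) =
      ⇔-trans (difference-swap⇔ _ _ _) (difference⇔sum _ _ (- gain e))

    module _ (C : Circle R Φ) where
      open Circle C using (k; v; c; joins)

      step : Fin (suc (suc k)) → Carrier
      step t = dgain R Φ (joins t) + pot (v (next t))

      sum-step : sum step ≈ circleGain R Φ C + sum (pot ∘ v)
      sum-step = begin
        sum step                                 ≈⟨ ∑-distrib-+ gains (pot ∘ v ∘ next) ⟩
        sum gains + sum (pot ∘ v ∘ next)         ≡⟨ cong (_+ sum (pot ∘ v ∘ next)) (sumF≡sum gains) ⟨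
        circleGain R Φ C + sum (pot ∘ v ∘ next)  ≈⟨ +-congˡ (sum-rotate (pot ∘ v)) ⟩
        circleGain R Φ C + sum (pot ∘ v)         ∎
        where
        gains : Fin (suc (suc k)) → Carrier
        gains t = dgain R Φ (joins t)

      balanced⇔sums-agree : Balanced R Φ C ⇔ (sum step ≈ sum (pot ∘ v))
      balanced⇔sums-agree = mk⇔
        (λ balanced → trans sum-step (trans (+-congʳ balanced) (+-identityˡ _)))
        (λ agree → identityˡ-unique _ _ (trans (sym sum-step) agree))

      on-edge⇔step : ∀ t → _∈h_ R Φ {Q = Q} P (c t) ⇔ (step t ≈ pot (v t))
      on-edge⇔step t = ∈h⇔potential-step (joins t)

lemma5p2 : ∀ {c ℓ : Level} (R : CommutativeRing c ℓ) {n d : ℕ} (Φ : GainGraph R n)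
             (Q : Fin n → Point R d) → AdjDistinct R Φ Q → (C : Circle R Φ) →
             ((¬ Balanced R Φ C) →
                ∀ (P : Point R d) → ¬ (∀ t → _∈h_ R Φ {Q = Q} P (Circle.c C t)))
             × (Balanced R Φ C → ∀ (s : Fin (suc (suc (Circle.k C)))) (P : Point R d) →
                ((∀ t → _∈h_ R Φ {Q = Q} P (Circle.c C t))
                 → (∀ t → t ≢ s → _∈h_ R Φ {Q = Q} P (Circle.c C t)))
                × ((∀ t → t ≢ s → _∈h_ R Φ {Q = Q} P (Circle.c C t))
                 → (∀ t → _∈h_ R Φ {Q = Q} P (Circle.c C t))))
lemma5p2 R Φ Q _ C = unbalanced-empty , balanced-redundant
  where
  open Circle C using (c)
  open import Algebra.Properties.CommutativeMonoid.Sum (CommutativeRing.+-commutativeMonoid R)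
    using (sum-cong-≋)

  unbalanced-empty : ¬ Balanced R Φ C → ∀ P → ¬ (∀ t → _∈h_ R Φ {Q = Q} P (c t))
  unbalanced-empty unbalanced P onAll = unbalanced
    (from (balanced⇔sums-agree R Φ Q P C)
      (sum-cong-≋ (λ t → to (on-edge⇔step R Φ Q P C t) (onAll t))))

  balanced-redundant : Balanced R Φ C → ∀ s P →
    ((∀ t → _∈h_ R Φ {Q = Q} P (c t)) → (∀ t → t ≢ s → _∈h_ R Φ {Q = Q} P (c t)))
    × ((∀ t → t ≢ s → _∈h_ R Φ {Q = Q} P (c t)) → (∀ t → _∈h_ R Φ {Q = Q} P (c t)))
  balanced-redundant balanced s P = (λ onAll t _ → onAll t) , λ onOthers t →
    from (on-edge⇔step R Φ Q P C t)
      (sum-determines-missing-term R _ _ s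
        (to (balanced⇔sums-agree R Φ Q P C) balanced)
        (λ u u≢s → to (on-edge⇔step R Φ Q P C u) (onOthers u u≢s)) t)
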